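{- Let $\Sigma$ be a signed simple graph with even chromatic number and non-zero maximum deficiency. Then in every minimal coloration $\kappa$ of $\Sigma$ with $\operatorname{def}(\kappa)=\operatorname{M}(\Sigma)$, for every color $i$ in the deficiency set $\operatorname{D}(\kappa)$, the color $-i$ appears on both endpoints of some negative edge.
   Context: A signed simple graph is $\Sigma=(V,E,\sigma)$ where $(V,E)$ is a graph with no loops and no multiple edges and $\sigma:E\to\{+,-\}$. A proper coloration of $\Sigma$ is a function $\kappa: V \to \{\pm1,\ldots,\pm k,0\}$ such that for every edge $e$ with endpoints $a,b$, $\kappa(a)\neq \sigma(e)\kappa(b)$. Color sets are $\{\pm1,\ldots,\pm k\}$ (size $2k$) or $\{\pm1,\ldots,\pm k,0\}$ (size $2k+1$). The chromatic number $\chi(\Sigma)$ is the smallest size of a color set with which $\Sigma$ can be properly colored. A coloration is minimal if it is proper and takes values in a color set of size $\chi(\Sigma)$ (so if $\chi(\Sigma)=2k$, in $\{\pm1,\ldots,\pm k\}$). The deficiency $\operatorname{def}(\kappa)$ is the number of colors of the color set not used by $\kappa$, the deficiency set $\operatorname{D}(\kappa)$ is the set of those unused colors, and the maximum deficiency $\operatorname{M}(\Sigma)$ is the maximum of $\operatorname{def}(\kappa)$ over minimal proper colorations $\kappa$. -}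

module Defs where

open import Data.Nat using (ℕ; zero; suc; _≤_; _<_; _*_)
open import Data.Nat.DivMod using (_/_)
open import Data.Integer using (ℤ; +_; -[1+_]; -_) renaming (_≟_ to _≟ℤ_)
open import Data.Fin using (Fin)
open import Data.Fin.Properties using (any?)
open import Data.Maybe using (Maybe; just; nothing)
open import Data.List using (List; []; _∷_; length; filter)
open import Data.List.Membership.Propositional using (_∈_)
open import Data.Product using (Σ; ∃; ∃-syntax; _×_; _,_)
open import Relation.Nullary using (¬_; ¬?)
open import Relation.Binary.PropositionalEquality using (_≡_; _≢_)

data Sign : Set where
  plus minus : Sign

_·_ : Sign → ℤ → ℤ
plus  · c = c
minus · c = - c

-- A (finite) signed simple graph on vertex set Fin n:
-- edge a b = just s  iff  {a,b} is an edge with sign s.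
-- Symmetric (undirected, at most one edge per pair) and loopless.
record SignedGraph (n : ℕ) : Set where
  field
    edge     : Fin n → Fin n → Maybe Sign
    symm     : ∀ a b → edge a b ≡ edge b a
    loopless : ∀ a → edge a a ≡ nothing
open SignedGraph public

-- The colour set of size m:
--   m = 2k     : {±1,…,±k}
--   m = 2k + 1 : {±1,…,±k,0}
colorSet : ℕ → List ℤ
colorSet zero = []
colorSet (suc zero) = + 0 ∷ []
colorSet (suc (suc m)) = + suc (m / 2) ∷ -[1+ m / 2 ] ∷ colorSet m

Coloration : ℕ → Set
Coloration n = Fin n → ℤ

Proper : ∀ {n} → SignedGraph n → Coloration n → Set
Proper G κ = ∀ a b s → edge G a b ≡ just s → κ a ≢ (s · κ b)

ProperIn : ∀ {n} → SignedGraph n → ℕ → Coloration n → Set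
ProperIn G m κ = Proper G κ × (∀ v → κ v ∈ colorSet m)

IsChromaticNumber : ∀ {n} → SignedGraph n → ℕ → Set
IsChromaticNumber G m =
  (∃[ κ ] ProperIn G m κ) × (∀ m′ → m′ < m → ∀ κ → ¬ ProperIn G m′ κ)

-- Minimal coloration, given χ(Σ) = m.
Minimal : ∀ {n} → SignedGraph n → ℕ → Coloration n → Set
Minimal G m κ = ProperIn G m κ

Used : ∀ {n} → Coloration n → ℤ → Set
Used {n} κ c = ∃[ v ] κ v ≡ c

deficiency : ∀ {n} → ℕ → Coloration n → ℕ
deficiency m κ = length (filter (λ c → ¬? (any? (λ v → κ v ≟ℤ c))) (colorSet m))

InDeficiencySet : ∀ {n} → ℕ → Coloration n → ℤ → Set
InDeficiencySet m κ i = (i ∈ colorSet m) × ¬ Used κ i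

IsMaxDeficiency : ∀ {n} → SignedGraph n → ℕ → ℕ → Set
IsMaxDeficiency G m d =
  (∃[ κ ] (Minimal G m κ × deficiency m κ ≡ d)) ×
  (∀ κ → Minimal G m κ → deficiency m κ ≤ d)

-- If no negative edge has both ends coloured −i, apply the colour symmetry exchanging
-- ±∣i∣ with ±k, which lets us assume ∣i∣ = k. Then recolour every vertex of colour −i
-- by 0: since i is unused, the remaining colours lie in {±1,…,±(k−1)}, and the only
-- edges that could become improper are negative edges joining two vertices of colour −i.
-- This is a proper colouring with 2k − 1 colours, contradicting χ(Σ) = 2k.
module Submission where

open import Defs
open import Data.Nat using (ℕ; _*_)
open import Data.Integer using (-_)
open import Data.Maybe using (just)
open import Data.Product using (∃-syntax; _×_)
open import Relation.Binary.PropositionalEquality using (_≡_; _≢_)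

open import Data.Nat using (zero; suc; _≤_; z≤n; s≤s; _≟_)
open import Data.Nat.Properties using (*-suc; ≤-refl; ≤-pred; ≤∧≢⇒<; m≤n⇒m≤1+n; n≤0⇒n≡0; suc-injective)
open import Data.Nat.DivMod using (_/_; m/n≡1+[m∸n]/n)
open import Data.Integer using (ℤ; +_; -[1+_]; ∣_∣) renaming (_≟_ to _≟ℤ_)
open import Data.Integer.Properties using (neg-involutive; ∣-i∣≡∣i∣; ∣i∣≡0⇒i≡0)
open import Data.Maybe using (nothing)
open import Data.Fin.Properties using (any?)
open import Data.List.Membership.Propositional using (_∈_)
open import Data.List.Relation.Unary.Any using (here; there)
open import Data.Product using (_,_; proj₁; proj₂)
open import Data.Sum using (_⊎_; inj₁; inj₂; [_,_])
open import Function using (_∘_)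
open import Function.Definitions using (Injective)
open import Relation.Nullary using (¬_; Dec; yes; no; contradiction)
open import Relation.Nullary.Decidable using (_×-dec_)
open import Relation.Binary.PropositionalEquality using (refl; sym; trans; cong; subst)

double : ℕ → ℕ
double zero    = zero
double (suc k) = suc (suc (double k))

2*k≡double : ∀ k → 2 * k ≡ double k
2*k≡double zero    = refl
2*k≡double (suc k) = trans (*-suc 2 k) (cong (suc ∘ suc) (2*k≡double k))

suc-suc-/2 : ∀ m → suc (suc m) / 2 ≡ suc (m / 2)
suc-suc-/2 m = m/n≡1+[m∸n]/n {suc (suc m)} (s≤s (s≤s z≤n))

double/2 : ∀ k → double k / 2 ≡ k
double/2 zero    = refl
double/2 (suc k) = trans (suc-suc-/2 (double k)) (cong suc (double/2 k))

suc-double/2 : ∀ k → suc (double k) / 2 ≡ k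
suc-double/2 zero    = refl
suc-double/2 (suc k) = trans (suc-suc-/2 (suc (double k))) (cong suc (suc-double/2 k))

∣∣≡⇒≡⊎≡- : ∀ x y → ∣ x ∣ ≡ ∣ y ∣ → x ≡ y ⊎ x ≡ - y
∣∣≡⇒≡⊎≡- (+ m)    (+ n)     eq   = inj₁ (cong +_ eq)
∣∣≡⇒≡⊎≡- (+ m)    -[1+ n ]  eq   = inj₂ (cong +_ eq)
∣∣≡⇒≡⊎≡- -[1+ m ] (+ _)     refl = inj₂ refl
∣∣≡⇒≡⊎≡- -[1+ m ] -[1+ n ]  eq   = inj₁ (cong -[1+_] (suc-injective eq))

∈colorSet-double⇒ : ∀ k {c} → c ∈ colorSet (double k) → c ≢ + 0 × ∣ c ∣ ≤ k
∈colorSet-double⇒ (suc k) c∈ rewrite double/2 k with c∈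
... | here refl         = (λ ()) , ≤-refl
... | there (here refl) = (λ ()) , ≤-refl
... | there (there c∈′) with ∈colorSet-double⇒ k c∈′
...   | c≢0 , ∣c∣≤k = c≢0 , m≤n⇒m≤1+n ∣c∣≤k

∈colorSet-double⇐ : ∀ k {c} → c ≢ + 0 → ∣ c ∣ ≤ k → c ∈ colorSet (double k)
∈colorSet-double⇐ zero    c≢0 ∣c∣≤0 = contradiction (∣i∣≡0⇒i≡0 (n≤0⇒n≡0 ∣c∣≤0)) c≢0
∈colorSet-double⇐ (suc k) {c} c≢0 ∣c∣≤ rewrite double/2 k with ∣ c ∣ ≟ suc k
... | no ∣c∣≢ = there (there (∈colorSet-double⇐ k c≢0 (≤-pred (≤∧≢⇒< ∣c∣≤ ∣c∣≢))))
... | yes ∣c∣≡ with ∣∣≡⇒≡⊎≡- c (+ suc k) ∣c∣≡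
...   | inj₁ refl = here refl
...   | inj₂ refl = there (here refl)

∈colorSet-suc-double⇐ : ∀ k {c} → ∣ c ∣ ≤ k → c ∈ colorSet (suc (double k))
∈colorSet-suc-double⇐ zero    ∣c∣≤0 = here (∣i∣≡0⇒i≡0 (n≤0⇒n≡0 ∣c∣≤0))
∈colorSet-suc-double⇐ (suc k) {c} ∣c∣≤ rewrite suc-double/2 k with ∣ c ∣ ≟ suc k
... | no ∣c∣≢ = there (there (∈colorSet-suc-double⇐ k (≤-pred (≤∧≢⇒< ∣c∣≤ ∣c∣≢))))
... | yes ∣c∣≡ with ∣∣≡⇒≡⊎≡- c (+ suc k) ∣c∣≡
...   | inj₁ refl = here refl
...   | inj₂ refl = there (here refl)

transpose : ℕ → ℕ → ℕ → ℕ
transpose j k n with n ≟ j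
... | yes _ = k
... | no _ with n ≟ k
... | yes _ = j
... | no _  = n

transpose-left : ∀ j k → transpose j k j ≡ k
transpose-left j k with j ≟ j
... | yes _   = refl
... | no j≢j  = contradiction refl j≢j

transpose-right : ∀ j k → transpose j k k ≡ j
transpose-right j k with k ≟ j
... | yes k≡j = k≡j
... | no _ with k ≟ k
... | yes _   = refl
... | no k≢k  = contradiction refl k≢k

transpose-fixes : ∀ {j k n} → n ≢ j → n ≢ k → transpose j k n ≡ n
transpose-fixes {j} {k} {n} n≢j n≢k with n ≟ j
... | yes n≡j = contradiction n≡j n≢j
... | no _ with n ≟ k
... | yes n≡k = contradiction n≡k n≢k
... | no _    = refl

transpose-involutive : ∀ j k n → transpose j k (transpose j k n) ≡ n
transpose-involutive j k n with n ≟ j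
... | yes refl = transpose-right n k
... | no n≢j with n ≟ k
... | yes refl = transpose-left j n
... | no n≢k   = transpose-fixes n≢j n≢k

transpose-≤ : ∀ {j k n b} → j ≤ b → k ≤ b → n ≤ b → transpose j k n ≤ b
transpose-≤ {j} {k} {n} j≤b k≤b n≤b with n ≟ j
... | yes _ = k≤b
... | no _ with n ≟ k
... | yes _ = j≤b
... | no _  = n≤b

oddExtension : (ℕ → ℕ) → ℤ → ℤ
oddExtension f (+ n)    = + f n
oddExtension f -[1+ n ] = - + f (suc n)

∣oddExtension∣ : ∀ f c → ∣ oddExtension f c ∣ ≡ f ∣ c ∣
∣oddExtension∣ f (+ n)    = refl
∣oddExtension∣ f -[1+ n ] = ∣-i∣≡∣i∣ (+ f (suc n))

module _ {f : ℕ → ℕ} (f0≡0 : f 0 ≡ 0) where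

  oddExtension-neg : ∀ c → oddExtension f (- c) ≡ - oddExtension f c
  oddExtension-neg (+ zero) rewrite f0≡0 = refl
  oddExtension-neg (+ suc n) = refl
  oddExtension-neg -[1+ n ]  = sym (neg-involutive (+ f (suc n)))

  oddExtension-involutive : (∀ n → f (f n) ≡ n) → ∀ c → oddExtension f (oddExtension f c) ≡ c
  oddExtension-involutive f-inv (+ n)    = cong +_ (f-inv n)
  oddExtension-involutive f-inv -[1+ n ] =
    trans (oddExtension-neg (+ f (suc n))) (cong (-_ ∘ +_) (f-inv (suc n)))

·-commute : (π : ℤ → ℤ) → (∀ c → π (- c) ≡ - π c) → ∀ s c → π (s · c) ≡ s · π c
·-commute π π-odd plus  c = refl
·-commute π π-odd minus c = π-odd c

·≡0⇒≡0 : ∀ s {c} → s · c ≡ + 0 → c ≡ + 0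
·≡0⇒≡0 plus  eq = eq
·≡0⇒≡0 minus {c} eq = trans (sym (neg-involutive c)) (cong -_ eq)

·-zero : ∀ s → s · (+ 0) ≡ + 0
·-zero plus  = refl
·-zero minus = refl

Proper-recolour : ∀ {n} {G : SignedGraph n} {κ} (π : ℤ → ℤ) →
  (∀ c → π (- c) ≡ - π c) → Injective _≡_ _≡_ π → Proper G κ → Proper G (π ∘ κ)
Proper-recolour {κ = κ} π π-odd π-inj proper a b s ab πκa≡ =
  proper a b s ab (π-inj (trans πκa≡ (sym (·-commute π π-odd s (κ b)))))

NegativeEdgeColoured : ∀ {n} → SignedGraph n → Coloration n → ℤ → Set
NegativeEdgeColoured G κ c = ∃[ a ] ∃[ b ] (edge G a b ≡ just minus × κ a ≡ c × κ b ≡ c)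

negativeEdgeColoured? : ∀ {n} (G : SignedGraph n) κ c → Dec (NegativeEdgeColoured G κ c)
negativeEdgeColoured? G κ c =
  any? λ a → any? λ b → isMinus (edge G a b) ×-dec (κ a ≟ℤ c) ×-dec (κ b ≟ℤ c)
  where
  isMinus : ∀ x → Dec (x ≡ just minus)
  isMinus (just minus) = yes refl
  isMinus (just plus)  = no λ ()
  isMinus nothing      = no λ ()

erase : ℤ → ℤ → ℤ
erase c x with x ≟ℤ c
... | yes _ = + 0
... | no _  = x

erase-respects : ∀ {c x y} s → x ≢ + 0 → y ≢ + 0 → x ≢ s · y →
  ¬ (s ≡ minus × x ≡ c × y ≡ c) → erase c x ≢ s · erase c y
erase-respects {c} {x} {y} s x≢0 y≢0 x≢sy notNegative with x ≟ℤ c | y ≟ℤ c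
erase-respects plus  _ _ x≢y _ | yes x≡c | yes y≡c = λ _ → x≢y (trans x≡c (sym y≡c))
erase-respects minus _ _ _ notNegative | yes x≡c | yes y≡c = λ _ → notNegative (refl , x≡c , y≡c)
... | yes _ | no _  = y≢0 ∘ ·≡0⇒≡0 s ∘ sym
... | no _  | yes _ = λ x≡s0 → x≢0 (trans x≡s0 (·-zero s))
... | no _  | no _  = x≢sy

Proper-erase : ∀ {n} {G : SignedGraph n} {κ c} → Proper G κ → (∀ v → κ v ≢ + 0) →
  ¬ NegativeEdgeColoured G κ c → Proper G (erase c ∘ κ)
Proper-erase {κ = κ} proper κ≢0 noEdge a b s ab =
  erase-respects s (κ≢0 a) (κ≢0 b) (proper a b s ab)
    λ { (refl , κa≡c , κb≡c) → noEdge (a , b , ab , κa≡c , κb≡c) }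

freeColourToTop : ∀ {n} {G : SignedGraph n} {K κ i} →
  ProperIn G (double K) κ → i ∈ colorSet (double K) → ¬ Used κ i →
  ¬ NegativeEdgeColoured G κ (- i) →
  ∃[ κ′ ] ∃[ i′ ] (ProperIn G (double K) κ′ × ∣ i′ ∣ ≡ K × ¬ Used κ′ i′ ×
                   ¬ NegativeEdgeColoured G κ′ (- i′))
freeColourToTop {G = G} {K} {κ} {i} (proper , κ∈) i∈ i-unused noEdge =
  τ ∘ κ , τ i , (Proper-recolour {G = G} {κ} τ τ-odd τ-injective proper , τ-preserves ∘ κ∈) ,
  ∣τi∣≡K , τi-unused , τ-noEdge
  where
  i≢0 : i ≢ + 0
  i≢0 = proj₁ (∈colorSet-double⇒ K i∈)

  ∣i∣≤K : ∣ i ∣ ≤ K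
  ∣i∣≤K = proj₂ (∈colorSet-double⇒ K i∈)

  t : ℕ → ℕ
  t = transpose ∣ i ∣ K

  t0≡0 : t 0 ≡ 0
  t0≡0 = transpose-fixes (i≢0 ∘ ∣i∣≡0⇒i≡0 ∘ sym)
    λ 0≡K → i≢0 (∣i∣≡0⇒i≡0 (n≤0⇒n≡0 (subst (∣ i ∣ ≤_) (sym 0≡K) ∣i∣≤K)))

  τ : ℤ → ℤ
  τ = oddExtension t

  τ-odd : ∀ c → τ (- c) ≡ - τ c
  τ-odd = oddExtension-neg t0≡0

  τ-injective : Injective _≡_ _≡_ τ
  τ-injective {x} {y} τx≡τy = trans (sym (τ-involutive x)) (trans (cong τ τx≡τy) (τ-involutive y))
    where τ-involutive = oddExtension-involutive t0≡0 (transpose-involutive ∣ i ∣ K)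

  τ-preserves : ∀ {c} → c ∈ colorSet (double K) → τ c ∈ colorSet (double K)
  τ-preserves {c} c∈ with ∈colorSet-double⇒ K c∈
  ... | c≢0 , ∣c∣≤K = ∈colorSet-double⇐ K
    (λ τc≡0 → c≢0 (τ-injective (trans τc≡0 (sym (cong +_ t0≡0)))))
    (subst (_≤ K) (sym (∣oddExtension∣ t c)) (transpose-≤ ∣i∣≤K ≤-refl ∣c∣≤K))

  ∣τi∣≡K : ∣ τ i ∣ ≡ K
  ∣τi∣≡K = trans (∣oddExtension∣ t i) (transpose-left ∣ i ∣ K)

  τi-unused : ¬ Used (τ ∘ κ) (τ i)
  τi-unused (v , τκv≡τi) = i-unused (v , τ-injective τκv≡τi)

  τ-noEdge : ¬ NegativeEdgeColoured G (τ ∘ κ) (- τ i)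
  τ-noEdge (a , b , ab , τκa≡ , τκb≡) =
    noEdge (a , b , ab , τ-injective (trans τκa≡ (sym (τ-odd i)))
                       , τ-injective (trans τκb≡ (sym (τ-odd i))))

eraseTopColour : ∀ {n} {G : SignedGraph n} {k κ i} →
  ProperIn G (double (suc k)) κ → ∣ i ∣ ≡ suc k → ¬ Used κ i →
  ¬ NegativeEdgeColoured G κ (- i) → ProperIn G (suc (double k)) (erase (- i) ∘ κ)
eraseTopColour {G = G} {k} {κ} {i} (proper , κ∈) ∣i∣≡ i-unused noEdge =
  Proper-erase {G = G} {κ} proper (proj₁ ∘ ∈colorSet-double⇒ (suc k) ∘ κ∈) noEdge ,
  λ v → erase-∈ (κ∈ v) (i-unused ∘ (v ,_))
  where
  erase-∈ : ∀ {x} → x ∈ colorSet (double (suc k)) → x ≢ i →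
    erase (- i) x ∈ colorSet (suc (double k))
  erase-∈ {x} x∈ x≢i with x ≟ℤ - i
  ... | yes _   = ∈colorSet-suc-double⇐ k z≤n
  ... | no x≢-i = ∈colorSet-suc-double⇐ k
    (≤-pred (≤∧≢⇒< (proj₂ (∈colorSet-double⇒ (suc k) x∈)) ∣x∣≢))
    where
    ∣x∣≢ : ∣ x ∣ ≢ suc k
    ∣x∣≢ ∣x∣≡ = [ x≢i , x≢-i ] (∣∣≡⇒≡⊎≡- x i (trans ∣x∣≡ (sym ∣i∣≡)))

proposition3 : ∀ (n : ℕ) (G : SignedGraph n) (m k d : ℕ) →
    IsChromaticNumber G m → m ≡ 2 * k →
    IsMaxDeficiency G m d → d ≢ 0 →
    ∀ κ → Minimal G m κ → deficiency m κ ≡ d →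
    ∀ i → InDeficiencySet m κ i →
    ∃[ a ] ∃[ b ] (edge G a b ≡ just minus × κ a ≡ - i × κ b ≡ - i)
proposition3 n G m k d χ m≡2k _ _ κ κ-minimal _ i (i∈ , i-unused)
  with negativeEdgeColoured? G κ (- i)
... | yes edge  = edge
... | no noEdge with k | trans m≡2k (2*k≡double k)
...   | zero   | refl = contradiction i∈ λ ()
...   | suc k′ | refl =
  let κ′ , i′ , κ′-proper , ∣i′∣≡ , i′-unused , κ′-noEdge =
        freeColourToTop {G = G} κ-minimal i∈ i-unused noEdge
  in contradiction (eraseTopColour {G = G} κ′-proper ∣i′∣≡ i′-unused κ′-noEdge)
                   (proj₂ χ (suc (double k′)) ≤-refl (erase (- i′) ∘ κ′))
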